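{- Let $\mathbf{L}\in\{\mathbf{I^1},\mathbf{I^2},\mathbf{P^1},\mathbf{P^2}\}$ and let $\varphi,\psi$ be $\mathbf{L}$-contingent formulas of the language of $\mathbf{L}$. If $\varphi\models_{\mathbf{L}}\psi$, then one can construct a formula $\chi$ of the language of $\mathbf{L}$ such that every atom of $\chi$ occurs in both $\varphi$ and $\psi$, $\varphi\models_{\mathbf{L}}\chi$, and $\chi\models_{\mathbf{L}}\psi$.
   Context: All four logics have formulas built from propositional atoms with $\neg,\wedge,\vee,\rightarrow$, interpreted by homomorphisms $h$ into $\{0,u,1\}$. $\mathbf{I^1}$: designated set $D=\{1\}$; $h(\varphi\wedge\psi)=1$ if $h(\varphi)=h(\psi)=1$ and $0$ otherwise; $h(\varphi\vee\psi)=1$ if $h(\varphi)=1$ or $h(\psi)=1$, and $0$ otherwise; $h(\varphi\rightarrow\psi)=0$ if $h(\varphi)=1$ and $h(\psi)\neq1$, and $1$ otherwise; negation is Heyting's: $\neg1=0,\ \neg u=0,\ \neg0=1$. $\mathbf{I^2}$: as $\mathbf{I^1}$ but with Kleene negation $\neg1=0,\ \neg u=u,\ \neg0=1$. $\mathbf{P^1}$: designated set $D=\{1,u\}$; $h(\varphi\wedge\psi)=1$ if $h(\varphi)\neq0$ and $h(\psi)\neq0$, and $0$ otherwise; $h(\varphi\vee\psi)=0$ if $h(\varphi)=h(\psi)=0$, and $1$ otherwise; $h(\varphi\rightarrow\psi)=0$ if $h(\varphi)\neq0$ and $h(\psi)=0$, and $1$ otherwise; negation is Bochvar's: $\neg1=0,\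 \neg u=1,\ \neg0=1$. $\mathbf{P^2}$: as $\mathbf{P^1}$ but with Kleene negation $\neg1=0,\ \neg u=u,\ \neg0=1$. $\varphi\models_{\mathbf{L}}\psi$ means: for every such homomorphism $h$, if $h(\varphi)\in D$ then $h(\psi)\in D$. A formula is $\mathbf{L}$-contingent iff there is a homomorphism giving it a designated value and one giving it a non-designated value. -}

module Defs where

open import Data.Nat using (ℕ)
open import Data.List using (List; []; _∷_; _++_)
open import Data.List.Membership.Propositional using (_∈_)
open import Data.Product using (Σ; ∃; _×_; _,_)
open import Relation.Binary.PropositionalEquality using (_≡_)
open import Relation.Nullary using (¬_)

data Formula : Set where
  atom : ℕ → Formula
  ~_   : Formula → Formula
  _∧_  : Formula → Formula → Formula
  _∨_  : Formula → Formula → Formula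
  _⇒_  : Formula → Formula → Formula

infixr 6 _∧_
infixr 5 _∨_
infixr 4 _⇒_
infix  7 ~_

atoms : Formula → List ℕ
atoms (atom p) = p ∷ []
atoms (~ φ)    = atoms φ
atoms (φ ∧ ψ)  = atoms φ ++ atoms ψ
atoms (φ ∨ ψ)  = atoms φ ++ atoms ψ
atoms (φ ⇒ ψ)  = atoms φ ++ atoms ψ

data V3 : Set where
  v0 vu v1 : V3

data Logic : Set where
  I1 I2 P1 P2 : Logic

Designated : Logic → V3 → Set
Designated I1 v = v ≡ v1
Designated I2 v = v ≡ v1
Designated P1 v = ¬ (v ≡ v0)
Designated P2 v = ¬ (v ≡ v0)

negHeyting : V3 → V3
negHeyting v1 = v0
negHeyting vu = v0
negHeyting v0 = v1

negKleene : V3 → V3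
negKleene v1 = v0
negKleene vu = vu
negKleene v0 = v1

negBochvar : V3 → V3
negBochvar v1 = v0
negBochvar vu = v1
negBochvar v0 = v1

-- I-connectives (only 1 counts as "true").
andI : V3 → V3 → V3
andI v1 v1 = v1
andI _  _  = v0

orI : V3 → V3 → V3
orI v1 _  = v1
orI _  v1 = v1
orI _  _  = v0

impI : V3 → V3 → V3
impI v1 v1 = v1
impI v1 _  = v0
impI _  _  = v1

-- P-connectives (anything non-0 counts as "true").
andP : V3 → V3 → V3
andP v0 _  = v0
andP _  v0 = v0
andP _  _  = v1

orP : V3 → V3 → V3
orP v0 v0 = v0
orP _  _  = v1

impP : V3 → V3 → V3
impP v0 _  = v1
impP _  v0 = v0
impP _  _  = v1

negL : Logic → V3 → V3
negL I1 = negHeyting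
negL I2 = negKleene
negL P1 = negBochvar
negL P2 = negKleene

andL : Logic → V3 → V3 → V3
andL I1 = andI
andL I2 = andI
andL P1 = andP
andL P2 = andP

orL : Logic → V3 → V3 → V3
orL I1 = orI
orL I2 = orI
orL P1 = orP
orL P2 = orP

impL : Logic → V3 → V3 → V3
impL I1 = impI
impL I2 = impI
impL P1 = impP
impL P2 = impP

eval : Logic → (ℕ → V3) → Formula → V3
eval L h (atom p) = h p
eval L h (~ φ)    = negL L (eval L h φ)
eval L h (φ ∧ ψ)  = andL L (eval L h φ) (eval L h ψ)
eval L h (φ ∨ ψ)  = orL L (eval L h φ) (eval L h ψ)
eval L h (φ ⇒ ψ)  = impL L (eval L h φ) (eval L h ψ)

_⊨[_]_ : Formula → Logic → Formula → Set
φ ⊨[ L ] ψ = (h : ℕ → V3) → Designated L (eval L h φ) → Designated L (eval L h ψ)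

Contingent : Logic → Formula → Set
Contingent L φ = (∃ λ h → Designated L (eval L h φ))
               × (∃ λ h → ¬ Designated L (eval L h φ))

-- In each of the four logics designation commutes with ∧ and ∨ (both behave
-- classically on "designated or not"), and each value v of an atom p is defined
-- by a formula char L p v in p alone.  Hence for a finite set C of atoms the
-- diagram of a valuation g, the conjunction of char L q (g q) over q ∈ C, holds
-- exactly at the valuations agreeing with g on C.  Take C the atoms shared by φ
-- and ψ, and χ the disjunction of the diagrams of the (finitely many, up to
-- agreement on the atoms of φ) models of φ.  Every model of φ satisfies its own
-- diagram, so φ ⊨ χ.  For χ ⊨ ψ splice: if h agrees on C with a model g of φ,
-- the valuation equal to g on the atoms of φ and to h elsewhere is a model of φ,
-- hence of ψ, and agrees with h on the atoms of ψ.  Without constants the empty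
-- conjunction and disjunction must be built from an atom of C; C is non-empty
-- because otherwise the same splicing would make φ unsatisfiable or ψ valid,
-- and this is where contingency enters.

module Submission where

open import Defs
open import Data.Bool using (Bool; true; false; T) renaming (_∧_ to _∧ᵇ_; _∨_ to _∨ᵇ_)
open import Data.Bool.Properties using (T-∧; T-∨; T?)
open import Data.Empty using (⊥-elim)
open import Data.List using (List; []; _∷_; map; foldr; filter; cartesianProductWith)
open import Data.List.Membership.Propositional using (_∈_; _∉_; find; lose)
open import Data.List.Membership.Propositional.Properties
  using (∈-filter⁺; ∈-filter⁻; ∈-cartesianProductWith⁺)
open import Data.List.Relation.Unary.All as All using (All; []; _∷_)
import Data.List.Relation.Unary.All.Properties as AllP
open import Data.List.Relation.Unary.Any using (Any; here; there)
import Data.List.Relation.Unary.Any.Properties as AnyP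
open import Data.Nat using (ℕ)
import Data.Nat as Nat
open import Data.List.Membership.DecPropositional Nat._≟_ using (_∈?_)
open import Data.Product using (Σ; ∃-syntax; _×_; _,_; proj₁; proj₂)
open import Data.Product.Function.NonDependent.Propositional using (_×-⇔_)
open import Data.Sum using (_⊎_; inj₁; inj₂; [_,_]′)
open import Data.Sum.Function.Propositional using (_⊎-⇔_)
open import Function using (_∘_; const; case_of_; _⇔_; mk⇔; Equivalence)
open import Function.Properties.Equivalence using (⇔-setoid) renaming (sym to ⇔-sym)
open import Level using (0ℓ)
open import Relation.Binary.Definitions using (DecidableEquality)
open import Relation.Binary.PropositionalEquality
  using (_≡_; _≢_; refl; sym; trans; cong; cong₂; subst)
open import Relation.Nullary using (¬_; Dec; yes; no; ⌊_⌋; toWitness; fromWitness)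
import Relation.Nullary.Decidable as Dec
import Relation.Binary.Reasoning.Setoid as SetoidReasoning

open Equivalence using (to; from)

module ⇔-Reasoning = SetoidReasoning (⇔-setoid 0ℓ)

variable
  g h : ℕ → V3
  p q : ℕ
  C : List ℕ

isOne : V3 → Bool
isOne v1 = true
isOne _  = false

isNonzero : V3 → Bool
isNonzero v0 = false
isNonzero _  = true

designated : Logic → V3 → Bool
designated I1 = isOne
designated I2 = isOne
designated P1 = isNonzero
designated P2 = isNonzero

≡v1⇔isOne : ∀ v → v ≡ v1 ⇔ T (isOne v)
≡v1⇔isOne v0 = mk⇔ (λ ()) (λ ())
≡v1⇔isOne vu = mk⇔ (λ ()) (λ ())
≡v1⇔isOne v1 = mk⇔ _ (λ _ → refl)

≢v0⇔isNonzero : ∀ v → v ≢ v0 ⇔ T (isNonzero v)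
≢v0⇔isNonzero v0 = mk⇔ (λ v0≢v0 → v0≢v0 refl) (λ ())
≢v0⇔isNonzero vu = mk⇔ _ (λ _ ())
≢v0⇔isNonzero v1 = mk⇔ _ (λ _ ())

Designated⇔T : ∀ L v → Designated L v ⇔ T (designated L v)
Designated⇔T I1 = ≡v1⇔isOne
Designated⇔T I2 = ≡v1⇔isOne
Designated⇔T P1 = ≢v0⇔isNonzero
Designated⇔T P2 = ≢v0⇔isNonzero

isOne-andI : ∀ a b → isOne (andI a b) ≡ isOne a ∧ᵇ isOne b
isOne-andI v0 b  = refl
isOne-andI vu b  = refl
isOne-andI v1 v0 = refl
isOne-andI v1 vu = refl
isOne-andI v1 v1 = refl

isOne-orI : ∀ a b → isOne (orI a b) ≡ isOne a ∨ᵇ isOne b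
isOne-orI v1 b  = refl
isOne-orI v0 v0 = refl
isOne-orI v0 vu = refl
isOne-orI v0 v1 = refl
isOne-orI vu v0 = refl
isOne-orI vu vu = refl
isOne-orI vu v1 = refl

isNonzero-andP : ∀ a b → isNonzero (andP a b) ≡ isNonzero a ∧ᵇ isNonzero b
isNonzero-andP v0 b  = refl
isNonzero-andP vu v0 = refl
isNonzero-andP vu vu = refl
isNonzero-andP vu v1 = refl
isNonzero-andP v1 v0 = refl
isNonzero-andP v1 vu = refl
isNonzero-andP v1 v1 = refl

isNonzero-orP : ∀ a b → isNonzero (orP a b) ≡ isNonzero a ∨ᵇ isNonzero b
isNonzero-orP v0 v0 = refl
isNonzero-orP v0 vu = refl
isNonzero-orP v0 v1 = refl
isNonzero-orP vu b  = refl
isNonzero-orP v1 b  = refl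

designated-andL : ∀ L a b → designated L (andL L a b) ≡ designated L a ∧ᵇ designated L b
designated-andL I1 = isOne-andI
designated-andL I2 = isOne-andI
designated-andL P1 = isNonzero-andP
designated-andL P2 = isNonzero-andP

designated-orL : ∀ L a b → designated L (orL L a b) ≡ designated L a ∨ᵇ designated L b
designated-orL I1 = isOne-orI
designated-orL I2 = isOne-orI
designated-orL P1 = isNonzero-orP
designated-orL P2 = isNonzero-orP

Designated-andL : ∀ L a b → Designated L (andL L a b) ⇔ (Designated L a × Designated L b)
Designated-andL L a b = begin
  Designated L (andL L a b)                  ≈⟨ Designated⇔T L _ ⟩
  T (designated L (andL L a b))              ≡⟨ cong T (designated-andL L a b) ⟩
  T (designated L a ∧ᵇ designated L b)       ≈⟨ T-∧ ⟩
  (T (designated L a) × T (designated L b))  ≈⟨ Designated⇔T L a ×-⇔ Designated⇔T L b ⟨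
  (Designated L a × Designated L b)          ∎
  where open ⇔-Reasoning

Designated-orL : ∀ L a b → Designated L (orL L a b) ⇔ (Designated L a ⊎ Designated L b)
Designated-orL L a b = begin
  Designated L (orL L a b)                   ≈⟨ Designated⇔T L _ ⟩
  T (designated L (orL L a b))               ≡⟨ cong T (designated-orL L a b) ⟩
  T (designated L a ∨ᵇ designated L b)       ≈⟨ T-∨ ⟩
  (T (designated L a) ⊎ T (designated L b))  ≈⟨ Designated⇔T L a ⊎-⇔ Designated⇔T L b ⟨
  (Designated L a ⊎ Designated L b)          ∎
  where open ⇔-Reasoning

Designated-orL⁺ˡ : ∀ L {a b} → Designated L a → Designated L (orL L a b)
Designated-orL⁺ˡ L = from (Designated-orL L _ _) ∘ inj₁

Designated-orL⁺ʳ : ∀ L {a b} → Designated L b → Designated L (orL L a b)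
Designated-orL⁺ʳ L = from (Designated-orL L _ _) ∘ inj₂

Sat : Logic → (ℕ → V3) → Formula → Set
Sat L h φ = Designated L (eval L h φ)

AgreeOn : List ℕ → (ℕ → V3) → (ℕ → V3) → Set
AgreeOn xs g h = All (λ q → g q ≡ h q) xs

eval-cong : ∀ L φ → AgreeOn (atoms φ) g h → eval L g φ ≡ eval L h φ
eval-cong L (atom p) (gp≡hp ∷ []) = gp≡hp
eval-cong L (~ φ)    g≈h = cong (negL L) (eval-cong L φ g≈h)
eval-cong L (φ ∧ ψ)  g≈h =
  cong₂ (andL L) (eval-cong L φ (AllP.++⁻ˡ (atoms φ) g≈h))
                (eval-cong L ψ (AllP.++⁻ʳ (atoms φ) g≈h))
eval-cong L (φ ∨ ψ)  g≈h =
  cong₂ (orL L) (eval-cong L φ (AllP.++⁻ˡ (atoms φ) g≈h))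
                (eval-cong L ψ (AllP.++⁻ʳ (atoms φ) g≈h))
eval-cong L (φ ⇒ ψ)  g≈h =
  cong₂ (impL L) (eval-cong L φ (AllP.++⁻ˡ (atoms φ) g≈h))
                (eval-cong L ψ (AllP.++⁻ʳ (atoms φ) g≈h))

Sat-cong : ∀ L φ → AgreeOn (atoms φ) g h → Sat L g φ → Sat L h φ
Sat-cong L φ g≈h = subst (Designated L) (eval-cong L φ g≈h)

charI : ℕ → V3 → Formula
charI p v0 = ~ atom p
charI p vu = ~ (atom p ∨ ~ atom p)
charI p v1 = atom p

-- In the P-logics the atom itself is designated at u too, so 1 is isolated through ~.
charP : ℕ → V3 → Formula
charP p v0 = ~ (atom p ∨ atom p)
charP p vu = atom p ∧ ~ atom p
charP p v1 = ~ (~ atom p ∨ ~ atom p)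

char : Logic → ℕ → V3 → Formula
char I1 = charI
char I2 = charI
char P1 = charP
char P2 = charP

atoms-charI : ∀ p v → All (_≡ p) (atoms (charI p v))
atoms-charI p v0 = refl ∷ []
atoms-charI p vu = refl ∷ refl ∷ []
atoms-charI p v1 = refl ∷ []

atoms-charP : ∀ p v → All (_≡ p) (atoms (charP p v))
atoms-charP p v0 = refl ∷ refl ∷ []
atoms-charP p vu = refl ∷ refl ∷ []
atoms-charP p v1 = refl ∷ refl ∷ []

atoms-char : ∀ L p v → All (_≡ p) (atoms (char L p v))
atoms-char I1 = atoms-charI
atoms-char I2 = atoms-charI
atoms-char P1 = atoms-charP
atoms-char P2 = atoms-charP

_≟_ : DecidableEquality V3
v0 ≟ v0 = yes refl
v0 ≟ vu = no λ ()
v0 ≟ v1 = no λ ()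
vu ≟ v0 = no λ ()
vu ≟ vu = yes refl
vu ≟ v1 = no λ ()
v1 ≟ v0 = no λ ()
v1 ≟ vu = no λ ()
v1 ≟ v1 = yes refl

V3-pointwise : {f g : V3 → Bool} → f v0 ≡ g v0 → f vu ≡ g vu → f v1 ≡ g v1 → ∀ x → f x ≡ g x
V3-pointwise e0 eu e1 v0 = e0
V3-pointwise e0 eu e1 vu = eu
V3-pointwise e0 eu e1 v1 = e1

designated-char : ∀ L p v x → designated L (eval L (const x) (char L p v)) ≡ ⌊ x ≟ v ⌋
designated-char I1 p v0 = V3-pointwise refl refl refl
designated-char I1 p vu = V3-pointwise refl refl refl
designated-char I1 p v1 = V3-pointwise refl refl refl
designated-char I2 p v0 = V3-pointwise refl refl refl
designated-char I2 p vu = V3-pointwise refl refl refl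
designated-char I2 p v1 = V3-pointwise refl refl refl
designated-char P1 p v0 = V3-pointwise refl refl refl
designated-char P1 p vu = V3-pointwise refl refl refl
designated-char P1 p v1 = V3-pointwise refl refl refl
designated-char P2 p v0 = V3-pointwise refl refl refl
designated-char P2 p vu = V3-pointwise refl refl refl
designated-char P2 p v1 = V3-pointwise refl refl refl

Sat-char : ∀ L {h} p v → Sat L h (char L p v) ⇔ h p ≡ v
Sat-char L {h} p v = begin
  Sat L h (char L p v)
    ≡⟨ cong (Designated L) (eval-cong L (char L p v) (All.map (cong h) (atoms-char L p v))) ⟩
  Sat L (const (h p)) (char L p v)
    ≈⟨ Designated⇔T L _ ⟩
  T (designated L (eval L (const (h p)) (char L p v)))
    ≡⟨ cong T (designated-char L p v (h p)) ⟩
  T ⌊ h p ≟ v ⌋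
    ≈⟨ mk⇔ toWitness fromWitness ⟩
  h p ≡ v ∎
  where open ⇔-Reasoning

falsum : Logic → ℕ → Formula
falsum L p = char L p v0 ∧ char L p v1

verum : Logic → ℕ → Formula
verum L p = char L p v0 ∨ char L p vu ∨ char L p v1

¬Sat-falsum : ∀ L {h} p → ¬ Sat L h (falsum L p)
¬Sat-falsum L p sat with to (Designated-andL L _ _) sat
... | hp≡v0 , hp≡v1 with trans (sym (to (Sat-char L p v0) hp≡v0)) (to (Sat-char L p v1) hp≡v1)
...   | ()

Sat-verum : ∀ L {h} p → Sat L h (verum L p)
Sat-verum L {h} p with h p in hp≡v
... | v0 = Designated-orL⁺ˡ L (from (Sat-char L p v0) hp≡v)
... | vu = Designated-orL⁺ʳ L (Designated-orL⁺ˡ L (from (Sat-char L p vu) hp≡v))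
... | v1 = Designated-orL⁺ʳ L (Designated-orL⁺ʳ L (from (Sat-char L p v1) hp≡v))

⋀ : Logic → ℕ → List Formula → Formula
⋀ L p = foldr _∧_ (verum L p)

⋁ : Logic → ℕ → List Formula → Formula
⋁ L p = foldr _∨_ (falsum L p)

Sat-⋀ : ∀ L {h} p χs → Sat L h (⋀ L p χs) ⇔ All (Sat L h) χs
Sat-⋀ L p []       = mk⇔ (const []) (const (Sat-verum L p))
Sat-⋀ L p (χ ∷ χs) = mk⇔
  (λ sat → let sχ , sχs = to (Designated-andL L _ _) sat in sχ ∷ to (Sat-⋀ L p χs) sχs)
  (λ { (sχ ∷ sχs) → from (Designated-andL L _ _) (sχ , from (Sat-⋀ L p χs) sχs) })

Sat-⋁ : ∀ L {h} p χs → Sat L h (⋁ L p χs) ⇔ Any (Sat L h) χs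
Sat-⋁ L p []       = mk⇔ (⊥-elim ∘ ¬Sat-falsum L p) (λ ())
Sat-⋁ L p (χ ∷ χs) = mk⇔
  ([ here , there ∘ to (Sat-⋁ L p χs) ]′ ∘ to (Designated-orL L _ _))
  (λ { (here sχ)   → Designated-orL⁺ˡ L sχ
      ; (there sχs) → Designated-orL⁺ʳ L (from (Sat-⋁ L p χs) sχs) })

AtomsWithin : List ℕ → Formula → Set
AtomsWithin C χ = All (_∈ C) (atoms χ)

char-within : ∀ L v → p ∈ C → AtomsWithin C (char L p v)
char-within L v p∈C = All.map (λ { refl → p∈C }) (atoms-char L _ v)

⋀-within : ∀ L χs → p ∈ C → All (AtomsWithin C) χs → AtomsWithin C (⋀ L p χs)
⋀-within L []       p∈C [] =
  AllP.++⁺ (char-within L v0 p∈C) (AllP.++⁺ (char-within L vu p∈C) (char-within L v1 p∈C))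
⋀-within L (χ ∷ χs) p∈C (χ⊆C ∷ χs⊆C) = AllP.++⁺ χ⊆C (⋀-within L χs p∈C χs⊆C)

⋁-within : ∀ L χs → p ∈ C → All (AtomsWithin C) χs → AtomsWithin C (⋁ L p χs)
⋁-within L []       p∈C [] = AllP.++⁺ (char-within L v0 p∈C) (char-within L v1 p∈C)
⋁-within L (χ ∷ χs) p∈C (χ⊆C ∷ χs⊆C) = AllP.++⁺ χ⊆C (⋁-within L χs p∈C χs⊆C)

diagram : Logic → ℕ → List ℕ → (ℕ → V3) → Formula
diagram L p C g = ⋀ L p (map (λ q → char L q (g q)) C)

Sat-diagram : ∀ L {h} p C g → Sat L h (diagram L p C g) ⇔ AgreeOn C h g
Sat-diagram L p C g = mk⇔
  (All.map (to (Sat-char L _ _)) ∘ AllP.map⁻ ∘ to (Sat-⋀ L p _))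
  (from (Sat-⋀ L p _) ∘ AllP.map⁺ ∘ All.map (from (Sat-char L _ _)))

diagram-within : ∀ L C g → p ∈ C → AtomsWithin C (diagram L p C g)
diagram-within L C g p∈C = ⋀-within L _ p∈C (AllP.map⁺ (All.tabulate (char-within L _)))

splice : List ℕ → (ℕ → V3) → (ℕ → V3) → ℕ → V3
splice xs g h q with q ∈? xs
... | yes _ = g q
... | no  _ = h q

splice-∈ : ∀ {xs} → q ∈ xs → splice xs g h q ≡ g q
splice-∈ {q = q} {xs = xs} q∈xs with q ∈? xs
... | yes _    = refl
... | no  q∉xs = ⊥-elim (q∉xs q∈xs)

splice-∉ : ∀ {xs} → q ∉ xs → splice xs g h q ≡ h q
splice-∉ {q = q} {xs = xs} q∉xs with q ∈? xs
... | yes q∈xs = ⊥-elim (q∉xs q∈xs)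
... | no  _    = refl

shared : Formula → Formula → List ℕ
shared φ ψ = filter (_∈? atoms ψ) (atoms φ)

∈-shared⁺ : ∀ φ ψ → q ∈ atoms φ → q ∈ atoms ψ → q ∈ shared φ ψ
∈-shared⁺ φ ψ = ∈-filter⁺ (_∈? atoms ψ)

∈-shared⁻ : ∀ φ ψ → q ∈ shared φ ψ → q ∈ atoms φ × q ∈ atoms ψ
∈-shared⁻ φ ψ = ∈-filter⁻ (_∈? atoms ψ) {xs = atoms φ}

⊨-transfer : ∀ L φ ψ → φ ⊨[ L ] ψ → Sat L g φ → AgreeOn (shared φ ψ) g h → Sat L h ψ
⊨-transfer {g = g} {h = h} L φ ψ φ⊨ψ gφ g≈h =
  Sat-cong L ψ k≈h (φ⊨ψ k (Sat-cong L φ g≈k gφ))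
  where
  k : ℕ → V3
  k = splice (atoms φ) g h
  g≈k : AgreeOn (atoms φ) g k
  g≈k = All.tabulate (sym ∘ splice-∈)
  k≈h : AgreeOn (atoms ψ) k h
  k≈h = All.tabulate λ {q} q∈ψ → case q ∈? atoms φ of λ where
    (yes q∈φ) → trans (splice-∈ q∈φ) (All.lookup g≈h (∈-shared⁺ φ ψ q∈φ q∈ψ))
    (no  q∉φ) → splice-∉ q∉φ

shared-atom : ∀ L φ ψ → Sat L g φ → ¬ Sat L h ψ → φ ⊨[ L ] ψ → ∃[ p ] p ∈ shared φ ψ
shared-atom L φ ψ gφ ¬hψ φ⊨ψ with shared φ ψ | ⊨-transfer L φ ψ φ⊨ψ gφ
... | []    | transfer = ⊥-elim (¬hψ (transfer []))
... | p ∷ _ | _        = p , here refl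

_[_↦_] : (ℕ → V3) → ℕ → V3 → ℕ → V3
(g [ p ↦ v ]) q with q Nat.≟ p
... | yes _ = v
... | no  _ = g q

[↦]-agrees : ∀ q → g q ≡ h q → (g [ p ↦ h p ]) q ≡ h q
[↦]-agrees {p = p} q gq≡hq with q Nat.≟ p
... | yes refl = refl
... | no  _    = gq≡hq

[↦]-≡ : ∀ g p v → (g [ p ↦ v ]) p ≡ v
[↦]-≡ g p v with p Nat.≟ p
... | yes _   = refl
... | no  p≢p = ⊥-elim (p≢p refl)

allV3 : List V3
allV3 = v0 ∷ vu ∷ v1 ∷ []

∈-allV3 : ∀ v → v ∈ allV3
∈-allV3 v0 = here refl
∈-allV3 vu = there (here refl)
∈-allV3 v1 = there (there (here refl))

valuations : List ℕ → List (ℕ → V3)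
valuations []       = const v0 ∷ []
valuations (p ∷ ps) = cartesianProductWith (λ v g → g [ p ↦ v ]) allV3 (valuations ps)

valuations-complete : ∀ ps h → ∃[ g ] g ∈ valuations ps × AgreeOn ps g h
valuations-complete []       h = const v0 , here refl , []
valuations-complete (p ∷ ps) h with valuations-complete ps h
... | g , g∈ , g≈h =
  g [ p ↦ h p ] ,
  ∈-cartesianProductWith⁺ (λ v g → g [ p ↦ v ]) (∈-allV3 (h p)) g∈ ,
  [↦]-≡ g p (h p) ∷ All.map (λ {q} → [↦]-agrees q) g≈h

Sat? : ∀ L h φ → Dec (Sat L h φ)
Sat? L h φ = Dec.map (⇔-sym (Designated⇔T L _)) (T? _)

models : Logic → Formula → List (ℕ → V3)
models L φ = filter (λ g → Sat? L g φ) (valuations (atoms φ))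

models-complete : ∀ L φ → Sat L h φ → ∃[ g ] g ∈ models L φ × AgreeOn (atoms φ) h g
models-complete {h = h} L φ hφ with valuations-complete (atoms φ) h
... | g , g∈ , g≈h =
  g , ∈-filter⁺ (λ g → Sat? L g φ) g∈ (Sat-cong L φ (All.map sym g≈h) hφ) , All.map sym g≈h

models-sound : ∀ L φ → g ∈ models L φ → Sat L g φ
models-sound L φ g∈ = proj₂ (∈-filter⁻ (λ g → Sat? L g φ) {xs = valuations (atoms φ)} g∈)

modelDiagrams : Logic → Formula → Formula → ℕ → List Formula
modelDiagrams L φ ψ p = map (diagram L p (shared φ ψ)) (models L φ)

interpolant : Logic → Formula → Formula → ℕ → Formula
interpolant L φ ψ p = ⋁ L p (modelDiagrams L φ ψ p)

interpolant-within : ∀ L φ ψ → p ∈ shared φ ψ → AtomsWithin (shared φ ψ) (interpolant L φ ψ p)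
interpolant-within L φ ψ p∈ =
  ⋁-within L (modelDiagrams L φ ψ _) p∈
    (AllP.map⁺ (All.tabulate λ {g} _ → diagram-within L (shared φ ψ) g p∈))

⊨-interpolant : ∀ L φ ψ p → φ ⊨[ L ] interpolant L φ ψ p
⊨-interpolant L φ ψ p h hφ with models-complete L φ hφ
... | g , g∈ , h≈g =
  from (Sat-⋁ L p (modelDiagrams L φ ψ p))
    (AnyP.map⁺ (lose g∈ (from (Sat-diagram L p (shared φ ψ) g) h≈g-on-shared)))
  where
  h≈g-on-shared : AgreeOn (shared φ ψ) h g
  h≈g-on-shared = All.tabulate (All.lookup h≈g ∘ proj₁ ∘ ∈-shared⁻ φ ψ)

interpolant-⊨ : ∀ L φ ψ p → φ ⊨[ L ] ψ → interpolant L φ ψ p ⊨[ L ] ψ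
interpolant-⊨ L φ ψ p φ⊨ψ h hχ with find (AnyP.map⁻ (to (Sat-⋁ L p (modelDiagrams L φ ψ p)) hχ))
... | g , g∈ , h⊨diagram =
  ⊨-transfer L φ ψ φ⊨ψ (models-sound L φ g∈)
    (All.map sym (to (Sat-diagram L p (shared φ ψ) g) h⊨diagram))

mainTheorem4 : (L : Logic) (φ ψ : Formula) →
    Contingent L φ → Contingent L ψ → φ ⊨[ L ] ψ →
    Σ Formula (λ χ → ((p : ℕ) → p ∈ atoms χ → (p ∈ atoms φ × p ∈ atoms ψ))
                     × φ ⊨[ L ] χ × χ ⊨[ L ] ψ)
mainTheorem4 L φ ψ ((g , gφ) , _) (_ , (h , ¬hψ)) φ⊨ψ =
  let p , p∈shared = shared-atom L φ ψ gφ ¬hψ φ⊨ψ in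
  interpolant L φ ψ p ,
  (λ q → ∈-shared⁻ φ ψ ∘ All.lookup (interpolant-within L φ ψ p∈shared)) ,
  ⊨-interpolant L φ ψ p ,
  interpolant-⊨ L φ ψ p φ⊨ψ
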